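{- Let $A\subseteq[N]$ have distinct subset products. For $\mathbf r\in\mathbb{Z}^{\mathcal{P}_{\mathrm{large}}\cup\mathcal{P}_{\mathrm{med}}}$ let $A_{\mathbf r}=\{a\in A:(\mathbf{V}_{\mathrm{large}}\times\mathbf{V}_{\mathrm{med}})(a)=\mathbf r\}$, and let $R=\{\mathbf r:|A_{\mathbf r}|\ge2\}$. Then $$\sum_{\mathbf r\in R}|A_{\mathbf r}|=O(N^{1/3+o(1)}),$$ i.e. for every $\varepsilon>0$ there is $C_\varepsilon$ (independent of $N$ and $A$) with $\sum_{\mathbf r\in R}|A_{\mathbf r}|\le C_\varepsilon N^{1/3+\varepsilon}$.
   Context: A finite set $A\subset\mathbb{N}$ has distinct subset products if for any two distinct subsets $B,C\subseteq A$, $\prod_{b\in B}b\neq\prod_{c\in C}c$. Fix $N$; $\mathcal{P}_{\mathrm{med}}$ is the set of primes in $(N^{1/3},N^{1/2}]$ and $\mathcal{P}_{\mathrm{large}}$ the set of primes in $(N^{1/2},N]$. $V_p(n)$ is the exponent of the prime $p$ in $n$, and $(\mathbf{V}_{\mathrm{large}}\times\mathbf{V}_{\mathrm{med}})(n)=(V_p(n))_{p\in\mathcal{P}_{\mathrm{large}}\cup\mathcal{P}_{\mathrm{med}}}$. -}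

module Defs where

open import Data.Nat using (ℕ; zero; suc; _+_; _*_; _^_; _≤_; _<_; _≤?_; _<?_)
open import Data.Nat.Divisibility using (_∣?_)
open import Data.Nat.Primality using (prime?)
open import Data.Nat.Properties using (_≟_)
open import Data.List using (List; []; _∷_; length; filter; map; deduplicate; applyUpTo)
open import Data.Nat.ListAction using (sum)
open import Data.List.Properties using (≡-dec)
open import Data.Vec using (Vec; []; _∷_)
open import Data.Bool using (Bool; true; false)
open import Data.Fin.Subset using (Subset)
open import Relation.Binary.PropositionalEquality using (_≡_)
open import Relation.Nullary.Decidable using (_×-dec_)

-- V p n : the exponent of p in n, i.e. the number of e ∈ {1,…,n} with p^e ∣ n.
-- (For p ≥ 2 and n ≥ 1 this is exactly the p-adic valuation, since p^e ∣ n forces e ≤ n.)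
V : ℕ → ℕ → ℕ
V p n = length (filter (λ e → p ^ e ∣? n) (applyUpTo suc n))

-- The primes in P_large ∪ P_med = primes p with N^{1/3} < p ≤ N,
-- i.e. N < p^3 and p ≤ N, listed in increasing order.
medLargePrimes : ℕ → List ℕ
medLargePrimes N = filter (λ p → prime? p ×-dec (N <? p ^ 3)) (applyUpTo suc N)

VLM : ℕ → ℕ → List ℕ
VLM N n = map (λ p → V p n) (medLargePrimes N)

Ar : ℕ → List ℕ → List ℕ → List ℕ
Ar N A r = filter (λ a → ≡-dec _≟_ (VLM N a) r) A

-- R = { r : |A_r| ≥ 2 }  (only r realised by some a ∈ A can have |A_r| ≥ 2)
Rset : ℕ → List ℕ → List (List ℕ)
Rset N A = filter (λ r → 2 ≤? length (Ar N A r)) (deduplicate (≡-dec _≟_) (map (VLM N) A))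

repeatedMass : ℕ → List ℕ → ℕ
repeatedMass N A = sum (map (λ r → length (Ar N A r)) (Rset N A))

subProd : (A : List ℕ) → Subset (length A) → ℕ
subProd [] [] = 1
subProd (a ∷ A) (true ∷ s) = a * subProd A s
subProd (a ∷ A) (false ∷ s) = subProd A s

-- distinct subset products (A is assumed to have no repeated elements,
-- so masks correspond exactly to subsets of A)
DistinctSubsetProducts : List ℕ → Set
DistinctSubsetProducts A = ∀ (s t : Subset (length A)) → subProd A s ≡ subProd A t → s ≡ t

-- Pair up elements inside each repeated fibre A_r: this gives P disjoint pairs (a, b) with equal
-- valuations at every prime above N^{1/3}, covering all but at most one element of each fibre, so
-- Σ_{r ∈ R} |A_r| ≤ 3P. Choosing one element from every pair yields 2^P products, pairwise distinct since A
-- has distinct subset products, and all with the same valuations above N^{1/3}. They are therefore told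
-- apart by their valuations at the y ≤ N^{1/3} primes q with q³ ≤ N, each at most P N ≤ N², so
-- 2^P ≤ (N² + 1)^y and P = O(N^{1/3} log N). Raising to the power 3k, the factor (log N)^{3k} is absorbed
-- into N³, which gives the bound with C = 12k.

module Submission where

import Algebra.Properties.CommutativeSemigroup
open import Data.Bool using (true; false; not; if_then_else_)
open import Data.Empty using (⊥; ⊥-elim)
open import Data.Fin.Subset using (Subset) renaming (⊥ to ∅)
open import Data.List using (List; []; _∷_; [_]; _++_; length; filter; map; concatMap; deduplicate; applyUpTo; upTo)
import Data.List.Properties as List
open import Data.List.Properties
  using (≡-dec; applyUpTo-∷ʳ; filter-++; filter-accept; filter-reject; length-filter; length-applyUpTo;
         length-++; length-map; length-++-sucʳ; length-upTo; ++-assoc; map-cong-local)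
open import Data.List.Membership.Propositional using (_∈_)
open import Data.List.Membership.Propositional.Properties
  using (∈-∃++; ∈-++⁻; ∈-++⁺ˡ; ∈-++⁺ʳ; ∈-map⁺; ∈-map⁻; ∈-applyUpTo⁺; ∈-upTo⁺; ∈-concat⁺′; ∈-filter⁺; ∈-filter⁻)
open import Data.List.Relation.Binary.Permutation.Propositional as ↭
  using (_↭_; ↭-refl; ↭-sym; ↭-trans; ↭-reflexive; module PermutationReasoning)
import Data.List.Relation.Binary.Permutation.Propositional.Properties as ↭
open import Data.List.Relation.Unary.All using (All; []; _∷_)
import Data.List.Relation.Unary.All as All
import Data.List.Relation.Unary.All.Properties as All
open import Data.List.Relation.Unary.AllPairs using ([]; _∷_)
open import Data.List.Relation.Unary.Any using (here; there)
open import Data.List.Relation.Unary.Unique.Propositional using (Unique)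
import Data.List.Relation.Unary.Unique.Propositional.Properties as Unique
open import Data.Nat
open import Data.Nat.Divisibility
open import Data.Nat.DivMod using (_/_; _%_; m≡m%n+[m/n]*n; m%n<n)
open import Data.Nat.Induction using (<-rec)
open import Data.Nat.ListAction using (sum; product)
open import Data.Nat.Primality
open import Data.Nat.Primality.Factorisation using (factorise; PrimeFactorisation)
open import Data.Nat.Properties
open import Data.Nat.Solver using (module +-*-Solver)
open import Data.Product using (∃; ∃₂; _×_; _,_; proj₁; proj₂; map₁; uncurry)
open import Data.Sum using (inj₁; inj₂; [_,_]′)
open import Function using (_∘_)
open import Data.Vec using ([]; _∷_)
open import Data.Vec.Properties using (∷-injectiveˡ; ∷-injectiveʳ)
open import Relation.Binary.Definitions using (DecidableEquality)
open import Relation.Binary.PropositionalEquality hiding ([_])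
open import Relation.Nullary using (¬_; ¬?; yes; no)
open import Relation.Nullary.Decidable using (_×-dec_)
import Data.List.Relation.Unary.Unique.DecPropositional.Properties (≡-dec _≟_) as DedupUnique

open import Defs

open PrimeFactorisation using (factors; isFactorisation; factorsPrime)
open +-*-Solver using (solve; _:*_; _:^_; _:=_; con)
open Algebra.Properties.CommutativeSemigroup *-commutativeSemigroup using (x∙yz≈y∙xz)

prime>1 : ∀ {p} → Prime p → 1 < p
prime>1 {p} pp = nonTrivial⇒n>1 p {{prime⇒nonTrivial pp}}

prime>0 : ∀ {p} → Prime p → 0 < p
prime>0 pp = <-trans z<s (prime>1 pp)

quotient<dividend : ∀ {p} q → 1 < p → 0 < q * p → q < q * p
quotient<dividend (suc q) 1<p _ = m<m*n (suc q) _ 1<p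

^-monoʳ-∣ : ∀ p {a b} → a ≤ b → p ^ a ∣ p ^ b
^-monoʳ-∣ p {a} {b} a≤b with m≤n⇒∃[o]m+o≡n a≤b
... | d , refl = divides (p ^ d) (trans (^-distribˡ-+-* p a d) (*-comm (p ^ a) (p ^ d)))

n<m^n : ∀ {m} → 1 < m → ∀ n → n < m ^ n
n<m^n 1<m zero = z<s
n<m^n {m} 1<m (suc n) = begin-strict
  suc n       ≤⟨ n<m^n 1<m n ⟩
  m ^ n       <⟨ m<m*n (m ^ n) m {{>-nonZero (<-≤-trans z<s (n<m^n 1<m n))}} 1<m ⟩
  m ^ n * m   ≡⟨ *-comm (m ^ n) m ⟩
  m * m ^ n   ∎
  where open ≤-Reasoning

-- V only looks at the exponents 1 … n, so it is the exact exponent once that exponent is at most n.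
V-spec : ∀ p n c → (∀ e → p ^ e ∣ n → e ≤ c) → (∀ e → e ≤ c → p ^ e ∣ n) → c ≤ n → V p n ≡ c
V-spec p n c bounded divides-up-to c≤n = trans (count≡ n) (m≥n⇒m⊓n≡n c≤n)
  where
  test = λ e → p ^ e ∣? n
  count : ℕ → ℕ
  count m = length (filter test (applyUpTo suc m))
  last : ℕ → ℕ
  last m = length (filter test [ suc m ])
  open ≡-Reasoning
  count-suc : ∀ m → count (suc m) ≡ count m + last m
  count-suc m = begin
    length (filter test (applyUpTo suc (suc m)))
      ≡⟨ cong (λ l → length (filter test l)) (sym (applyUpTo-∷ʳ suc m)) ⟩
    length (filter test (applyUpTo suc m ++ [ suc m ]))
      ≡⟨ cong length (filter-++ test (applyUpTo suc m) [ suc m ]) ⟩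
    length (filter test (applyUpTo suc m) ++ filter test [ suc m ])
      ≡⟨ length-++ (filter test (applyUpTo suc m)) ⟩
    count m + last m
      ∎
  count≡ : ∀ m → count m ≡ m ⊓ c
  count≡ zero = refl
  count≡ (suc m) with suc m ≤? c
  ... | yes m<c = begin
    count (suc m)      ≡⟨ count-suc m ⟩
    count m + last m   ≡⟨ cong₂ _+_ (count≡ m) (cong length (filter-accept test {xs = []} (divides-up-to (suc m) m<c))) ⟩
    m ⊓ c + 1          ≡⟨ cong (_+ 1) (m≤n⇒m⊓n≡m (<⇒≤ m<c)) ⟩
    m + 1              ≡⟨ +-comm m 1 ⟩
    suc m              ≡⟨ sym (m≤n⇒m⊓n≡m m<c) ⟩
    suc m ⊓ c          ∎
  ... | no m≮c = begin
    count (suc m)      ≡⟨ count-suc m ⟩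
    count m + last m   ≡⟨ cong₂ _+_ (count≡ m) (cong length (filter-reject test {xs = []} (m≮c ∘ bounded (suc m)))) ⟩
    m ⊓ c + 0          ≡⟨ +-identityʳ _ ⟩
    m ⊓ c              ≡⟨ m≥n⇒m⊓n≡n c≤m ⟩
    c                  ≡⟨ sym (m≥n⇒m⊓n≡n (m≤n⇒m≤1+n c≤m)) ⟩
    suc m ⊓ c          ∎
    where c≤m = ≤-pred (≰⇒> m≮c)

V-^*coprime : ∀ {p} → Prime p → ∀ c u → ¬ p ∣ u → V p (p ^ c * u) ≡ c
V-^*coprime {p} pp c u p∤u = V-spec p (p ^ c * u) c bounded divides-up-to c≤n
  where
  instance _ = prime⇒nonZero pp
  u>0 : 0 < u
  u>0 = n≢0⇒n>0 (λ { refl → p∤u (p ∣0) })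
  bounded : ∀ e → p ^ e ∣ p ^ c * u → e ≤ c
  bounded e d with e ≤? c
  ... | yes e≤c = e≤c
  ... | no e≰c = ⊥-elim (p∤u (*-cancelˡ-∣ (p ^ c) {{m^n≢0 p c}}
                   (∣-trans (∣-reflexive (*-comm (p ^ c) p)) (∣-trans (^-monoʳ-∣ p (≰⇒> e≰c)) d))))
  divides-up-to : ∀ e → e ≤ c → p ^ e ∣ p ^ c * u
  divides-up-to e e≤c = ∣m⇒∣m*n u (^-monoʳ-∣ p e≤c)
  c≤n : c ≤ p ^ c * u
  c≤n = ≤-trans (<⇒≤ (n<m^n (prime>1 pp) c)) (m≤m*n (p ^ c) u {{>-nonZero u>0}})

*-positiveˡ : ∀ m {n} → 0 < m * n → 0 < m
*-positiveˡ (suc m) _ = z<s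

factorOutPrime : ∀ {p} → Prime p → ∀ n → 0 < n → ∃₂ λ c u → n ≡ p ^ c * u × ¬ p ∣ u
factorOutPrime {p} pp = <-rec _ go
  where
  go : ∀ n → (∀ {m} → m < n → 0 < m → ∃₂ λ c u → m ≡ p ^ c * u × ¬ p ∣ u) →
       0 < n → ∃₂ λ c u → n ≡ p ^ c * u × ¬ p ∣ u
  go n rec n>0 with p ∣? n
  ... | no p∤n = 0 , n , sym (+-identityʳ n) , p∤n
  ... | yes (divides q refl) with rec (quotient<dividend q (prime>1 pp) n>0) (*-positiveˡ q n>0)
  ...   | c , u , refl , p∤u = suc c , u , trans (*-comm (p ^ c * u) p) (sym (*-assoc p (p ^ c) u)) , p∤u

V-* : ∀ {p} → Prime p → ∀ m n → 0 < m → 0 < n → V p (m * n) ≡ V p m + V p n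
V-* {p} pp m n m>0 n>0 with factorOutPrime pp m m>0 | factorOutPrime pp n n>0
... | a , u , refl , p∤u | b , v , refl , p∤v = begin
  V p ((p ^ a * u) * (p ^ b * v))   ≡⟨ cong (V p) regroup ⟩
  V p (p ^ (a + b) * (u * v))       ≡⟨ V-^*coprime pp (a + b) (u * v) p∤uv ⟩
  a + b                             ≡⟨ sym (cong₂ _+_ (V-^*coprime pp a u p∤u) (V-^*coprime pp b v p∤v)) ⟩
  V p (p ^ a * u) + V p (p ^ b * v) ∎
  where
  open ≡-Reasoning
  p∤uv : ¬ p ∣ u * v
  p∤uv = [ p∤u , p∤v ]′ ∘ euclidsLemma u v pp
  regroup : (p ^ a * u) * (p ^ b * v) ≡ p ^ (a + b) * (u * v)
  regroup = begin
    (p ^ a * u) * (p ^ b * v)   ≡⟨ *-assoc (p ^ a) u (p ^ b * v) ⟩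
    p ^ a * (u * (p ^ b * v))   ≡⟨ cong (p ^ a *_) (x∙yz≈y∙xz u (p ^ b) v) ⟩
    p ^ a * (p ^ b * (u * v))   ≡⟨ sym (*-assoc (p ^ a) (p ^ b) (u * v)) ⟩
    (p ^ a * p ^ b) * (u * v)   ≡⟨ cong (_* (u * v)) (sym (^-distribˡ-+-* p a b)) ⟩
    p ^ (a + b) * (u * v)       ∎

V-coprime : ∀ {p} → Prime p → ∀ n → ¬ p ∣ n → V p n ≡ 0
V-coprime pp n p∤n = trans (cong (V _) (sym (*-identityˡ n))) (V-^*coprime pp 0 n p∤n)

V-1 : ∀ {p} → Prime p → V p 1 ≡ 0
V-1 pp = V-coprime pp 1 (λ p∣1 → <⇒≢ (prime>1 pp) (sym (∣1⇒≡1 p∣1)))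

V>0 : ∀ {p} → Prime p → ∀ n → 0 < n → p ∣ n → 0 < V p n
V>0 {p} pp n n>0 p∣n with factorOutPrime pp n n>0
... | zero , u , refl , p∤u = ⊥-elim (p∤u (subst (p ∣_) (*-identityˡ u) p∣n))
... | suc c , u , refl , p∤u = subst (0 <_) (sym (V-^*coprime pp (suc c) u p∤u)) z<s

V-beyond : ∀ {p} → Prime p → ∀ n → 0 < n → n < p → V p n ≡ 0
V-beyond pp n n>0 n<p = V-coprime pp n (λ p∣n → <⇒≱ n<p (∣⇒≤ {{>-nonZero n>0}} p∣n))

V≤ : ∀ p n → V p n ≤ n
V≤ p n = ≤-trans (length-filter (λ e → p ^ e ∣? n) (applyUpTo suc n)) (≤-reflexive (length-applyUpTo suc n))

primeDivisor : ∀ n → 1 < n → ∃ λ p → Prime p × p ∣ n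
primeDivisor n@(suc _) 1<n with factors (factorise n) | isFactorisation (factorise n) | factorsPrime (factorise n)
... | []     | n≡1    | _      = ⊥-elim (<⇒≢ 1<n (sym n≡1))
... | p ∷ ps | n≡pΠps | pp ∷ _ = p , pp , divides (product ps) (trans n≡pΠps (*-comm p (product ps)))

V≡0⇒≡1 : ∀ n → 0 < n → (∀ p → Prime p → V p n ≡ 0) → n ≡ 1
V≡0⇒≡1 n n>0 V≡0 with 1 <? n
... | no n≯1 = ≤-antisym (≮⇒≥ n≯1) n>0
... | yes 1<n with primeDivisor n 1<n
...   | p , pp , p∣n = ⊥-elim (<⇒≢ (V>0 pp n n>0 p∣n) (sym (V≡0 p pp)))

-- Unique factorisation, read through valuations: divide out a common prime and recurse.
V-injective : ∀ m n → 0 < m → 0 < n → (∀ p → Prime p → V p m ≡ V p n) → m ≡ n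
V-injective = <-rec _ go
  where
  go : ∀ m → (∀ {m′} → m′ < m → ∀ n → 0 < m′ → 0 < n → (∀ p → Prime p → V p m′ ≡ V p n) → m′ ≡ n) →
       ∀ n → 0 < m → 0 < n → (∀ p → Prime p → V p m ≡ V p n) → m ≡ n
  go m rec n m>0 n>0 same with 1 <? m
  ... | no m≯1 = trans m≡1 (sym (V≡0⇒≡1 n n>0 λ p pp → trans (sym (same p pp)) (trans (cong (V p) m≡1) (V-1 pp))))
    where m≡1 = ≤-antisym (≮⇒≥ m≯1) m>0
  ... | yes 1<m with primeDivisor m 1<m
  ...   | p , pp , divides q refl with p ∣? n
  ...     | no p∤n = ⊥-elim (<⇒≢ (V>0 pp (q * p) m>0 (n∣m*n q)) (sym (trans (same p pp) (V-coprime pp n p∤n))))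
  ...     | yes (divides r refl) =
    cong (_* p) (rec (quotient<dividend q (prime>1 pp) m>0) r (*-positiveˡ q m>0) (*-positiveˡ r n>0) same′)
    where
    same′ : ∀ p′ → Prime p′ → V p′ q ≡ V p′ r
    same′ p′ pp′ = +-cancelʳ-≡ (V p′ p) (V p′ q) (V p′ r) (begin
      V p′ q + V p′ p   ≡⟨ sym (V-* pp′ q p (*-positiveˡ q m>0) (prime>0 pp)) ⟩
      V p′ (q * p)      ≡⟨ same p′ pp′ ⟩
      V p′ (r * p)      ≡⟨ V-* pp′ r p (*-positiveˡ r n>0) (prime>0 pp) ⟩
      V p′ r + V p′ p   ∎)
      where open ≡-Reasoning

subProd-injective-along : ∀ {m} ys (f : Subset m → Subset (length ys)) (g : Subset m → ℕ) →
  (∀ s → subProd ys (f s) ≡ g s) → (∀ {s t} → f s ≡ f t → s ≡ t) →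
  DistinctSubsetProducts ys → ∀ s t → g s ≡ g t → s ≡ t
subProd-injective-along ys f g f-prod f-inj distinct s t gs≡gt =
  f-inj (distinct (f s) (f t) (trans (f-prod s) (trans gs≡gt (sym (f-prod t)))))

reorder : ∀ {xs ys : List ℕ} → xs ↭ ys → Subset (length ys) → Subset (length xs)
reorder ↭.refl s = s
reorder (↭.prep x p) (b ∷ s) = b ∷ reorder p s
reorder (↭.swap x y p) (b ∷ c ∷ s) = c ∷ b ∷ reorder p s
reorder (↭.trans p q) s = reorder p (reorder q s)

subProd-reorder : ∀ {xs ys} (p : xs ↭ ys) s → subProd xs (reorder p s) ≡ subProd ys s
subProd-reorder ↭.refl s = refl
subProd-reorder (↭.prep x p) (true ∷ s) = cong (x *_) (subProd-reorder p s)
subProd-reorder (↭.prep x p) (false ∷ s) = subProd-reorder p s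
subProd-reorder (↭.swap x y p) (true ∷ true ∷ s) = trans (cong (λ z → x * (y * z)) (subProd-reorder p s)) (x∙yz≈y∙xz x y _)
subProd-reorder (↭.swap x y p) (true ∷ false ∷ s) = cong (y *_) (subProd-reorder p s)
subProd-reorder (↭.swap x y p) (false ∷ true ∷ s) = cong (x *_) (subProd-reorder p s)
subProd-reorder (↭.swap x y p) (false ∷ false ∷ s) = subProd-reorder p s
subProd-reorder (↭.trans p q) s = trans (subProd-reorder p (reorder q s)) (subProd-reorder q s)

reorder-injective : ∀ {xs ys} (p : xs ↭ ys) {s t} → reorder p s ≡ reorder p t → s ≡ t
reorder-injective ↭.refl eq = eq
reorder-injective (↭.prep x p) {_ ∷ _} {_ ∷ _} eq =
  cong₂ _∷_ (∷-injectiveˡ eq) (reorder-injective p (∷-injectiveʳ eq))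
reorder-injective (↭.swap x y p) {_ ∷ _ ∷ _} {_ ∷ _ ∷ _} eq =
  cong₂ _∷_ (∷-injectiveˡ (∷-injectiveʳ eq)) (cong₂ _∷_ (∷-injectiveˡ eq) (reorder-injective p (∷-injectiveʳ (∷-injectiveʳ eq))))
reorder-injective (↭.trans p q) eq = reorder-injective q (reorder-injective p eq)

DSP-resp-↭ : ∀ {xs ys} → xs ↭ ys → DistinctSubsetProducts xs → DistinctSubsetProducts ys
DSP-resp-↭ {xs} p = subProd-injective-along xs (reorder p) _ (subProd-reorder p) (reorder-injective p)

subProd-∅ : ∀ (ys : List ℕ) → subProd ys ∅ ≡ 1
subProd-∅ [] = refl
subProd-∅ (y ∷ ys) = subProd-∅ ys

padʳ : ∀ (xs ys : List ℕ) → Subset (length xs) → Subset (length (xs ++ ys))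
padʳ [] ys [] = ∅
padʳ (x ∷ xs) ys (b ∷ s) = b ∷ padʳ xs ys s

subProd-padʳ : ∀ xs ys s → subProd (xs ++ ys) (padʳ xs ys s) ≡ subProd xs s
subProd-padʳ [] ys [] = subProd-∅ ys
subProd-padʳ (x ∷ xs) ys (true ∷ s) = cong (x *_) (subProd-padʳ xs ys s)
subProd-padʳ (x ∷ xs) ys (false ∷ s) = subProd-padʳ xs ys s

padʳ-injective : ∀ xs ys {s t} → padʳ xs ys s ≡ padʳ xs ys t → s ≡ t
padʳ-injective [] ys {[]} {[]} eq = refl
padʳ-injective (x ∷ xs) ys {_ ∷ _} {_ ∷ _} eq = cong₂ _∷_ (∷-injectiveˡ eq) (padʳ-injective xs ys (∷-injectiveʳ eq))

DSP-++⁻ˡ : ∀ xs ys → DistinctSubsetProducts (xs ++ ys) → DistinctSubsetProducts xs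
DSP-++⁻ˡ xs ys = subProd-injective-along (xs ++ ys) (padʳ xs ys) _ (subProd-padʳ xs ys) (padʳ-injective xs ys)

flatten : List (ℕ × ℕ) → List ℕ
flatten [] = []
flatten ((a , b) ∷ ps) = a ∷ b ∷ flatten ps

choiceProd : ∀ (ps : List (ℕ × ℕ)) → Subset (length ps) → ℕ
choiceProd [] [] = 1
choiceProd ((a , b) ∷ ps) (x ∷ s) = (if x then a else b) * choiceProd ps s

pairMask : ∀ (ps : List (ℕ × ℕ)) → Subset (length ps) → Subset (length (flatten ps))
pairMask [] [] = []
pairMask ((a , b) ∷ ps) (x ∷ s) = x ∷ not x ∷ pairMask ps s

subProd-pairMask : ∀ ps s → subProd (flatten ps) (pairMask ps s) ≡ choiceProd ps s
subProd-pairMask [] [] = refl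
subProd-pairMask ((a , b) ∷ ps) (true ∷ s) = cong (a *_) (subProd-pairMask ps s)
subProd-pairMask ((a , b) ∷ ps) (false ∷ s) = cong (b *_) (subProd-pairMask ps s)

pairMask-injective : ∀ ps {s t} → pairMask ps s ≡ pairMask ps t → s ≡ t
pairMask-injective [] {[]} {[]} eq = refl
pairMask-injective ((a , b) ∷ ps) {_ ∷ _} {_ ∷ _} eq =
  cong₂ _∷_ (∷-injectiveˡ eq) (pairMask-injective ps (∷-injectiveʳ (∷-injectiveʳ eq)))

choiceProd-injective : ∀ {A} ps rest → A ↭ flatten ps ++ rest → DistinctSubsetProducts A →
                       ∀ s t → choiceProd ps s ≡ choiceProd ps t → s ≡ t
choiceProd-injective ps rest A↭ distinct =
  subProd-injective-along (flatten ps) (pairMask ps) (choiceProd ps) (subProd-pairMask ps) (pairMask-injective ps)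
    (DSP-++⁻ˡ (flatten ps) rest (DSP-resp-↭ A↭ distinct))

pairConsecutive : List ℕ → List (ℕ × ℕ) × List ℕ
pairConsecutive (x ∷ y ∷ zs) = map₁ ((x , y) ∷_) (pairConsecutive zs)
pairConsecutive xs = [] , xs

pairConsecutive-++ : ∀ xs → flatten (proj₁ (pairConsecutive xs)) ++ proj₂ (pairConsecutive xs) ≡ xs
pairConsecutive-++ [] = refl
pairConsecutive-++ (x ∷ []) = refl
pairConsecutive-++ (x ∷ y ∷ zs) = cong (λ l → x ∷ y ∷ l) (pairConsecutive-++ zs)

length-pairConsecutive : ∀ xs → length xs ≤ suc (2 * length (proj₁ (pairConsecutive xs)))
length-pairConsecutive [] = z≤n
length-pairConsecutive (x ∷ []) = ≤-refl
length-pairConsecutive (x ∷ y ∷ zs) =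
  ≤-trans (s≤s (s≤s (length-pairConsecutive zs))) (≤-reflexive (cong suc (sym (*-distribˡ-+ 2 1 _))))

-- At most one element is left over and there is at least one pair, so length ≤ 1 + 2P ≤ 3P.
length≤3*pairs : ∀ xs → 2 ≤ length xs → length xs ≤ 3 * length (proj₁ (pairConsecutive xs))
length≤3*pairs xs 2≤|xs| with length (proj₁ (pairConsecutive xs)) | length-pairConsecutive xs
... | zero  | |xs|≤1 = ⊥-elim (<⇒≱ 2≤|xs| |xs|≤1)
... | suc n | |xs|≤ = ≤-trans |xs|≤ (+-monoˡ-≤ (2 * suc n) (s≤s z≤n))

flatten-++ : ∀ ps qs → flatten (ps ++ qs) ≡ flatten ps ++ flatten qs
flatten-++ [] qs = refl
flatten-++ ((a , b) ∷ ps) qs = cong (λ l → a ∷ b ∷ l) (flatten-++ ps qs)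

All-flatten⁻ : ∀ {P : ℕ → Set} ps → All P (flatten ps) → All (λ ab → P (proj₁ ab) × P (proj₂ ab)) ps
All-flatten⁻ [] [] = []
All-flatten⁻ ((a , b) ∷ ps) (pa ∷ pb ∷ rest) = (pa , pb) ∷ All-flatten⁻ ps rest

++-interchange-↭ : ∀ {A : Set} (ws xs ys zs : List A) → (ws ++ xs) ++ (ys ++ zs) ↭ (ws ++ ys) ++ (xs ++ zs)
++-interchange-↭ ws xs ys zs = begin
  (ws ++ xs) ++ (ys ++ zs)   ≡⟨ ++-assoc ws xs (ys ++ zs) ⟩
  ws ++ xs ++ ys ++ zs       ↭⟨ ↭.++⁺ˡ ws (↭.shifts xs ys) ⟩
  ws ++ ys ++ xs ++ zs       ≡⟨ sym (++-assoc ws ys (xs ++ zs)) ⟩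
  (ws ++ ys) ++ (xs ++ zs)   ∎
  where open PermutationReasoning

module _ {B : Set} (_≟ᴮ_ : DecidableEquality B) (g : ℕ → B) where

  fibre : List ℕ → B → List ℕ
  fibre L r = filter (λ a → g a ≟ᴮ r) L

  offFibre : B → List ℕ → List ℕ
  offFibre r L = filter (λ a → ¬? (g a ≟ᴮ r)) L

  fibre-offFibre : ∀ {r r′} → r′ ≢ r → ∀ L → fibre (offFibre r L) r′ ≡ fibre L r′
  fibre-offFibre r′≢r [] = refl
  fibre-offFibre {r} {r′} r′≢r (a ∷ L) with g a ≟ᴮ r
  ... | yes ga≡r with g a ≟ᴮ r′
  ...   | yes ga≡r′ = ⊥-elim (r′≢r (trans (sym ga≡r′) ga≡r))
  ...   | no  _     = fibre-offFibre r′≢r L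
  fibre-offFibre {r} {r′} r′≢r (a ∷ L) | no _ with g a ≟ᴮ r′
  ...   | yes _ = cong (a ∷_) (fibre-offFibre r′≢r L)
  ...   | no  _ = fibre-offFibre r′≢r L

  pairConsecutive-within : ∀ {r} xs → All (λ a → g a ≡ r) xs →
                           All (λ ab → g (proj₁ ab) ≡ g (proj₂ ab)) (proj₁ (pairConsecutive xs))
  pairConsecutive-within [] _ = []
  pairConsecutive-within (x ∷ []) _ = []
  pairConsecutive-within (x ∷ y ∷ zs) (gx≡r ∷ gy≡r ∷ rest) = trans gx≡r (sym gy≡r) ∷ pairConsecutive-within zs rest

  fibre-split : ∀ r L → L ↭ fibre L r ++ offFibre r L
  fibre-split r [] = ↭-refl
  fibre-split r (a ∷ L) with g a ≟ᴮ r
  ... | yes _ = ↭.prep a (fibre-split r L)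
  ... | no  _ = ↭-trans (↭.prep a (fibre-split r L)) (↭-sym (↭.shift a (fibre L r) (offFibre r L)))

  -- Pair off each fibre r ∈ K consecutively; the fibres are disjoint, so the pairs use distinct elements of L.
  pairWithinFibres : ∀ K L → Unique K → All (λ r → 2 ≤ length (fibre L r)) K →
    ∃₂ λ ps rest → L ↭ flatten ps ++ rest × All (λ ab → g (proj₁ ab) ≡ g (proj₂ ab)) ps ×
                   sum (map (λ r → length (fibre L r)) K) ≤ 3 * length ps
  pairWithinFibres [] L _ _ = [] , L , ↭-refl , [] , z≤n
  pairWithinFibres (r ∷ K) L (r∉K ∷ K-unique) (2≤|Lr| ∷ K-repeated)
    with pairWithinFibres K (offFibre r L) K-unique (All.zipWith fibres-agree (r∉K , K-repeated))
    where
    fibres-agree : ∀ {r′} → r ≢ r′ × 2 ≤ length (fibre L r′) → 2 ≤ length (fibre (offFibre r L) r′)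
    fibres-agree (r≢r′ , 2≤) = subst (λ l → 2 ≤ length l) (sym (fibre-offFibre (≢-sym r≢r′) L)) 2≤
  ... | psR , restR , off↭ , sameR , massR =
    psC ++ psR , leftover ++ restR , perm , All.++⁺ sameC sameR , mass
    where
    psC = proj₁ (pairConsecutive (fibre L r))
    leftover = proj₂ (pairConsecutive (fibre L r))
    sameC = pairConsecutive-within (fibre L r) (All.all-filter (λ a → g a ≟ᴮ r) L)
    perm : L ↭ flatten (psC ++ psR) ++ (leftover ++ restR)
    perm = begin
      L                                                     ↭⟨ fibre-split r L ⟩
      fibre L r ++ offFibre r L                             ↭⟨ ↭.++⁺ (↭-reflexive (sym (pairConsecutive-++ (fibre L r)))) off↭ ⟩
      (flatten psC ++ leftover) ++ (flatten psR ++ restR)   ↭⟨ ++-interchange-↭ (flatten psC) leftover (flatten psR) restR ⟩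
      (flatten psC ++ flatten psR) ++ leftover ++ restR     ≡⟨ cong (_++ leftover ++ restR) (sym (flatten-++ psC psR)) ⟩
      flatten (psC ++ psR) ++ leftover ++ restR             ∎
      where open PermutationReasoning
    mass : length (fibre L r) + sum (map (λ r′ → length (fibre L r′)) K) ≤ 3 * length (psC ++ psR)
    mass = begin
      length (fibre L r) + sum (map (λ r′ → length (fibre L r′)) K)
        ≡⟨ cong (λ l → length (fibre L r) + sum l) (map-cong-local (All.map fibre-length-agrees r∉K)) ⟩
      length (fibre L r) + sum (map (λ r′ → length (fibre (offFibre r L) r′)) K)
        ≤⟨ +-mono-≤ (length≤3*pairs (fibre L r) 2≤|Lr|) massR ⟩
      3 * length psC + 3 * length psR   ≡⟨ sym (*-distribˡ-+ 3 (length psC) (length psR)) ⟩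
      3 * (length psC + length psR)     ≡⟨ cong (3 *_) (sym (length-++ psC)) ⟩
      3 * length (psC ++ psR)           ∎
      where
      open ≤-Reasoning
      fibre-length-agrees : ∀ {r′} → r ≢ r′ → length (fibre L r′) ≡ length (fibre (offFibre r L) r′)
      fibre-length-agrees r≢r′ = cong length (sym (fibre-offFibre (≢-sym r≢r′) L))

unique-⊆⇒length≤ : ∀ {A : Set} (xs ys : List A) → Unique xs → (∀ {x} → x ∈ xs → x ∈ ys) → length xs ≤ length ys
unique-⊆⇒length≤ [] ys _ _ = z≤n
unique-⊆⇒length≤ (x ∷ xs) ys (x∉xs ∷ xs-unique) xs⊆ys with ∈-∃++ (xs⊆ys (here refl))
... | us , vs , refl = ≤-trans (s≤s (unique-⊆⇒length≤ xs (us ++ vs) xs-unique xs⊆us++vs))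
                               (≤-reflexive (sym (length-++-sucʳ us x vs)))
  where
  xs⊆us++vs : ∀ {z} → z ∈ xs → z ∈ us ++ vs
  xs⊆us++vs {z} z∈xs with ∈-++⁻ us (xs⊆ys (there z∈xs))
  ... | inj₁ z∈us = ∈-++⁺ˡ z∈us
  ... | inj₂ (here refl) = ⊥-elim (All.lookup x∉xs z∈xs refl)
  ... | inj₂ (there z∈vs) = ∈-++⁺ʳ us z∈vs

∈-applyUpTo-suc : ∀ {x n} → 0 < x → x ≤ n → x ∈ applyUpTo suc n
∈-applyUpTo-suc {suc x} _ x<n = ∈-applyUpTo⁺ suc x<n

length≤bound : ∀ {L n} → Unique L → All (λ x → 0 < x × x ≤ n) L → length L ≤ n
length≤bound {L} {n} L-unique inRange =
  ≤-trans (unique-⊆⇒length≤ L (applyUpTo suc n) L-unique (λ x∈L → uncurry ∈-applyUpTo-suc (All.lookup inRange x∈L)))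
          (≤-reflexive (length-applyUpTo suc n))

allSubsets : ∀ n → List (Subset n)
allSubsets zero = [ [] ]
allSubsets (suc n) = map (true ∷_) (allSubsets n) ++ map (false ∷_) (allSubsets n)

length-allSubsets : ∀ n → length (allSubsets n) ≡ 2 ^ n
length-allSubsets zero = refl
length-allSubsets (suc n) = begin
  length (map (true ∷_) (allSubsets n) ++ map (false ∷_) (allSubsets n))
    ≡⟨ length-++ (map (true ∷_) (allSubsets n)) ⟩
  length (map (true ∷_) (allSubsets n)) + length (map (false ∷_) (allSubsets n))
    ≡⟨ cong₂ _+_ (length-map _ (allSubsets n)) (length-map _ (allSubsets n)) ⟩
  length (allSubsets n) + length (allSubsets n)   ≡⟨ cong (λ m → m + m) (length-allSubsets n) ⟩
  2 ^ n + 2 ^ n                                   ≡⟨ cong (2 ^ n +_) (sym (+-identityʳ (2 ^ n))) ⟩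
  2 ^ suc n                                       ∎
  where open ≡-Reasoning

allSubsets-unique : ∀ n → Unique (allSubsets n)
allSubsets-unique zero = [] ∷ []
allSubsets-unique (suc n) =
  Unique.++⁺ (Unique.map⁺ ∷-injectiveʳ (allSubsets-unique n)) (Unique.map⁺ ∷-injectiveʳ (allSubsets-unique n)) disjoint
  where
  disjoint : ∀ {s} → ¬ (s ∈ map (true ∷_) (allSubsets n) × s ∈ map (false ∷_) (allSubsets n))
  disjoint (s∈T , s∈F) with ∈-map⁻ (true ∷_) s∈T | ∈-map⁻ (false ∷_) s∈F
  ... | _ , _ , refl | _ , _ , ()

boundedLists : ℕ → ℕ → List (List ℕ)
boundedLists zero B = [ [] ]
boundedLists (suc y) B = concatMap (λ x → map (x ∷_) (boundedLists y B)) (upTo (suc B))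

length-concatMap-prepend : ∀ (xs : List ℕ) (yss : List (List ℕ)) →
  length (concatMap (λ x → map (x ∷_) yss) xs) ≡ length xs * length yss
length-concatMap-prepend [] yss = refl
length-concatMap-prepend (x ∷ xs) yss =
  trans (length-++ (map (x ∷_) yss)) (cong₂ _+_ (length-map (x ∷_) yss) (length-concatMap-prepend xs yss))

length-boundedLists : ∀ y B → length (boundedLists y B) ≡ suc B ^ y
length-boundedLists zero B = refl
length-boundedLists (suc y) B =
  trans (length-concatMap-prepend (upTo (suc B)) (boundedLists y B))
        (cong₂ _*_ (length-upTo (suc B)) (length-boundedLists y B))

∈-boundedLists : ∀ B (v : List ℕ) → All (_≤ B) v → v ∈ boundedLists (length v) B
∈-boundedLists B [] [] = here refl
∈-boundedLists B (x ∷ v) (x≤B ∷ v≤B) =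
  ∈-concat⁺′ (∈-map⁺ (x ∷_) (∈-boundedLists B v v≤B)) (∈-map⁺ _ (∈-upTo⁺ (s≤s x≤B)))

injection-bound : ∀ n y B (f : Subset n → List ℕ) → (∀ {s t} → f s ≡ f t → s ≡ t) →
  (∀ s → length (f s) ≡ y) → (∀ s → All (_≤ B) (f s)) → 2 ^ n ≤ suc B ^ y
injection-bound n y B f f-inj f-length f-bounded = begin
  2 ^ n                               ≡⟨ sym (length-allSubsets n) ⟩
  length (allSubsets n)               ≡⟨ sym (length-map f (allSubsets n)) ⟩
  length (map f (allSubsets n))       ≤⟨ unique-⊆⇒length≤ _ _ (Unique.map⁺ f-inj (allSubsets-unique n)) image⊆ ⟩
  length (boundedLists y B)           ≡⟨ length-boundedLists y B ⟩
  suc B ^ y                           ∎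
  where
  open ≤-Reasoning
  image⊆ : ∀ {v} → v ∈ map f (allSubsets n) → v ∈ boundedLists y B
  image⊆ v∈ with ∈-map⁻ f v∈
  ... | s , _ , refl = subst (λ l → f s ∈ boundedLists l B) (f-length s) (∈-boundedLists B (f s) (f-bounded s))

smallPrimes : ℕ → List ℕ
smallPrimes N = filter (λ q → prime? q ×-dec (q ^ 3 ≤? N)) (applyUpTo suc N)

n≤n^3 : ∀ n → n ≤ n ^ 3
n≤n^3 zero = z≤n
n≤n^3 n@(suc _) = m≤m*n n (n ^ 2)

∈-smallPrimes : ∀ {q N} → Prime q → q ^ 3 ≤ N → q ∈ smallPrimes N
∈-smallPrimes {N = N} qq q³≤N = ∈-filter⁺ (λ q → prime? q ×-dec (q ^ 3 ≤? N))
  (∈-applyUpTo-suc (prime>0 qq) (≤-trans (n≤n^3 _) q³≤N)) (qq , q³≤N)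

smallPrimes-unique : ∀ N → Unique (smallPrimes N)
smallPrimes-unique N = Unique.filter⁺ _ (Unique.applyUpTo⁺₁ suc N (λ i<j _ si≡sj → <⇒≢ i<j (suc-injective si≡sj)))

-- If N < y³ for y = length (smallPrimes N), every small prime is at most y - 1, so there are fewer than y.
length-smallPrimes : ∀ N → length (smallPrimes N) ^ 3 ≤ N
length-smallPrimes N = ≮⇒≥ (too-many (length (smallPrimes N)) refl)
  where
  too-many : ∀ y → length (smallPrimes N) ≡ y → N < y ^ 3 → ⊥
  too-many (suc y) |L|≡1+y N<y³ =
    1+n≰n (subst (_≤ y) |L|≡1+y (length≤bound (smallPrimes-unique N) (All.tabulate below)))
    where
    below : ∀ {q} → q ∈ smallPrimes N → 0 < q × q ≤ y
    below q∈ with ∈-filter⁻ (λ q → prime? q ×-dec (q ^ 3 ≤? N)) {xs = applyUpTo suc N} q∈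
    ... | _ , qq , q³≤N = prime>0 qq , ≮⇒≥ (λ y<q → <⇒≱ N<y³ (≤-trans (^-monoˡ-≤ 3 y<q) q³≤N))

≡-at-∈ : ∀ {A B : Set} {f g : A → B} {xs} → map f xs ≡ map g xs → ∀ {x} → x ∈ xs → f x ≡ g x
≡-at-∈ {xs = _ ∷ _} eq (here refl) = proj₁ (List.∷-injective eq)
≡-at-∈ {xs = _ ∷ _} eq (there x∈xs) = ≡-at-∈ (proj₂ (List.∷-injective eq)) x∈xs

-- The signature records every prime in (N^{1/3}, N]; primes above N divide no number in [1, N].
V≡-above-cube-root : ∀ {N p a b} → Prime p → N < p ^ 3 → 0 < a → a ≤ N → 0 < b → b ≤ N →
                     VLM N a ≡ VLM N b → V p a ≡ V p b
V≡-above-cube-root {N} {p} {a} {b} pp N<p³ a>0 a≤N b>0 b≤N same with p ≤? N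
... | yes p≤N = ≡-at-∈ same (∈-filter⁺ (λ p → prime? p ×-dec (N <? p ^ 3))
                              (∈-applyUpTo-suc (prime>0 pp) p≤N) (pp , N<p³))
... | no p≰N = trans (V-beyond pp a a>0 (≤-<-trans a≤N (≰⇒> p≰N)))
                     (sym (V-beyond pp b b>0 (≤-<-trans b≤N (≰⇒> p≰N))))

choiceProd-positive : ∀ ps s → All (0 <_) (flatten ps) → 0 < choiceProd ps s
choiceProd-positive [] [] [] = z<s
choiceProd-positive ((a , b) ∷ ps) (true ∷ s) (a>0 ∷ _ ∷ pos) = *-mono-< a>0 (choiceProd-positive ps s pos)
choiceProd-positive ((a , b) ∷ ps) (false ∷ s) (_ ∷ b>0 ∷ pos) = *-mono-< b>0 (choiceProd-positive ps s pos)

V-choiceProd : ∀ {p} → Prime p → ∀ ps → All (0 <_) (flatten ps) → All (λ ab → V p (proj₁ ab) ≡ V p (proj₂ ab)) ps →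
               ∀ s → V p (choiceProd ps s) ≡ sum (map (λ ab → V p (proj₁ ab)) ps)
V-choiceProd pp [] [] [] [] = V-1 pp
V-choiceProd {p} pp ((a , b) ∷ ps) (a>0 ∷ b>0 ∷ pos) (Va≡Vb ∷ same) (x ∷ s) = begin
  V p ((if x then a else b) * choiceProd ps s)            ≡⟨ V-* pp _ _ (picked-positive x) (choiceProd-positive ps s pos) ⟩
  V p (if x then a else b) + V p (choiceProd ps s)        ≡⟨ cong₂ _+_ (V-picked x) (V-choiceProd pp ps pos same s) ⟩
  V p a + sum (map (λ ab → V p (proj₁ ab)) ps)            ∎
  where
  open ≡-Reasoning
  picked-positive : ∀ x → 0 < (if x then a else b)
  picked-positive true = a>0
  picked-positive false = b>0
  V-picked : ∀ x → V p (if x then a else b) ≡ V p a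
  V-picked true = refl
  V-picked false = sym Va≡Vb

V-choiceProd≤ : ∀ {p N} → Prime p → ∀ ps → All (λ a → 0 < a × a ≤ N) (flatten ps) → ∀ s →
                V p (choiceProd ps s) ≤ length ps * N
V-choiceProd≤ pp [] [] [] = ≤-reflexive (V-1 pp)
V-choiceProd≤ {p} {N} pp ((a , b) ∷ ps) (a∈ ∷ b∈ ∷ inRange) (x ∷ s) = begin
  V p ((if x then a else b) * choiceProd ps s)       ≡⟨ V-* pp _ _ (proj₁ (picked x)) (choiceProd-positive ps s (All.map proj₁ inRange)) ⟩
  V p (if x then a else b) + V p (choiceProd ps s)   ≤⟨ +-mono-≤ (≤-trans (V≤ p _) (proj₂ (picked x))) (V-choiceProd≤ pp ps inRange s) ⟩
  N + length ps * N                                  ∎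
  where
  open ≤-Reasoning
  picked : ∀ x → 0 < (if x then a else b) × (if x then a else b) ≤ N
  picked true = a∈
  picked false = b∈

smallSignature : ℕ → ℕ → List ℕ
smallSignature N m = map (λ q → V q m) (smallPrimes N)

-- Two choice products agree at every prime above N^{1/3}, so their small signatures determine them.
smallSignature-injective : ∀ N ps → All (λ a → 0 < a × a ≤ N) (flatten ps) →
  All (λ ab → VLM N (proj₁ ab) ≡ VLM N (proj₂ ab)) ps → ∀ s t →
  smallSignature N (choiceProd ps s) ≡ smallSignature N (choiceProd ps t) → choiceProd ps s ≡ choiceProd ps t
smallSignature-injective N ps inRange same s t sig≡ =
  V-injective _ _ (choiceProd-positive ps s positive) (choiceProd-positive ps t positive) V≡
  where
  positive = All.map proj₁ inRange
  V≡ : ∀ p → Prime p → V p (choiceProd ps s) ≡ V p (choiceProd ps t)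
  V≡ p pp with p ^ 3 ≤? N
  ... | yes p³≤N = ≡-at-∈ sig≡ (∈-smallPrimes pp p³≤N)
  ... | no p³≰N = trans (V-choiceProd pp ps positive samePair s) (sym (V-choiceProd pp ps positive samePair t))
    where
    samePair : All (λ ab → V p (proj₁ ab) ≡ V p (proj₂ ab)) ps
    samePair = All.zipWith (λ { (((a>0 , a≤N) , (b>0 , b≤N)) , eq) → V≡-above-cube-root pp (≰⇒> p³≰N) a>0 a≤N b>0 b≤N eq })
                 (All-flatten⁻ ps inRange , same)

2^pairs≤ : ∀ {N A} ps rest → A ↭ flatten ps ++ rest → DistinctSubsetProducts A →
  All (λ a → 0 < a × a ≤ N) (flatten ps) → All (λ ab → VLM N (proj₁ ab) ≡ VLM N (proj₂ ab)) ps → length ps ≤ N →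
  2 ^ length ps ≤ suc (N * N) ^ length (smallPrimes N)
2^pairs≤ {N} ps rest A↭ distinct inRange same |ps|≤N =
  injection-bound (length ps) (length (smallPrimes N)) (N * N) (λ s → smallSignature N (choiceProd ps s))
    (λ {s} {t} eq → choiceProd-injective ps rest A↭ distinct s t (smallSignature-injective N ps inRange same s t eq))
    (λ s → length-map _ (smallPrimes N))
    (λ s → All.map⁺ (All.tabulate (entry s)))
  where
  entry : ∀ s {q} → q ∈ smallPrimes N → V q (choiceProd ps s) ≤ N * N
  entry s q∈ with ∈-filter⁻ (λ q → prime? q ×-dec (q ^ 3 ≤? N)) {xs = applyUpTo suc N} q∈
  ... | _ , qq , _ = ≤-trans (V-choiceProd≤ qq ps inRange s) (*-monoˡ-≤ N |ps|≤N)

^-distribʳ-* : ∀ m n o → (m * n) ^ o ≡ m ^ o * n ^ o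
^-distribʳ-* m n zero = refl
^-distribʳ-* m n (suc o) = trans (cong ((m * n) *_) (^-distribʳ-* m n o)) (interchange m n (m ^ o) (n ^ o))
  where
  interchange : ∀ a b c d → (a * b) * (c * d) ≡ (a * c) * (b * d)
  interchange = solve 4 (λ a b c d → (a :* b) :* (c :* d) := (a :* c) :* (b :* d)) refl

-- Write u = q m + r with r < m; then u ≤ m (q + 1) and q + 1 ≤ 2^q.
n^m≤m^m*2^n : ∀ m → 0 < m → ∀ u → u ^ m ≤ m ^ m * 2 ^ u
n^m≤m^m*2^n m@(suc _) _ u = begin
  u ^ m                    ≤⟨ ^-monoˡ-≤ m u≤m*[q+1] ⟩
  (m * suc q) ^ m          ≡⟨ ^-distribʳ-* m (suc q) m ⟩
  m ^ m * suc q ^ m        ≤⟨ *-monoʳ-≤ (m ^ m) (^-monoˡ-≤ m (n<m^n (s≤s (s≤s z≤n)) q)) ⟩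
  m ^ m * (2 ^ q) ^ m      ≡⟨ cong (m ^ m *_) (^-*-assoc 2 q m) ⟩
  m ^ m * 2 ^ (q * m)      ≤⟨ *-monoʳ-≤ (m ^ m) (^-monoʳ-≤ 2 q*m≤u) ⟩
  m ^ m * 2 ^ u            ∎
  where
  open ≤-Reasoning
  q = u / m
  u≡ : u ≡ u % m + q * m
  u≡ = m≡m%n+[m/n]*n u m
  u≤m*[q+1] : u ≤ m * suc q
  u≤m*[q+1] = ≤-trans (≤-reflexive u≡) (≤-trans (+-monoˡ-≤ (q * m) (<⇒≤ (m%n<n u m))) (≤-reflexive (*-comm (suc q) m)))
  q*m≤u : q * m ≤ u
  q*m≤u = ≤-trans (m≤n+m (q * m) (u % m)) (≤-reflexive (sym u≡))

binaryLength : ∀ N → 0 < N → ∃ λ X → N < 2 ^ X × 2 ^ X ≤ 2 * N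
binaryLength N N>0 = search N (n<m^n (s≤s (s≤s z≤n)) N)
  where
  search : ∀ t → N < 2 ^ t → ∃ λ X → N < 2 ^ X × 2 ^ X ≤ 2 * N
  search zero N<1 = ⊥-elim (<⇒≱ N<1 N>0)
  search (suc t) N<2^[1+t] with 2 ^ t ≤? N
  ... | yes 2^t≤N = suc t , N<2^[1+t] , *-monoʳ-≤ 2 2^t≤N
  ... | no 2^t≰N = search t (≰⇒> 2^t≰N)

-- 2^P ≤ (N² + 1)^y < (2^X)^(2y), so P ≤ 2Xy.
exponent≤ : ∀ {P N} X y → 2 ^ P ≤ suc (N * N) ^ y → N < 2 ^ X → P ≤ 2 * X * y
exponent≤ {P} {N} X y 2^P≤ N<2^X = ^-cancelʳ-≤ (begin
  2 ^ P                 ≤⟨ 2^P≤ ⟩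
  suc (N * N) ^ y       ≤⟨ ^-monoˡ-≤ y (≤-trans N²<[N+1]² (*-mono-≤ N<2^X N<2^X)) ⟩
  (2 ^ X * 2 ^ X) ^ y   ≡⟨ cong (_^ y) (sym (^-distribˡ-+-* 2 X X)) ⟩
  (2 ^ (X + X)) ^ y     ≡⟨ ^-*-assoc 2 (X + X) y ⟩
  2 ^ ((X + X) * y)     ≡⟨ cong (λ e → 2 ^ (e * y)) (cong (X +_) (sym (+-identityʳ X))) ⟩
  2 ^ (2 * X * y)       ∎)
  where
  open ≤-Reasoning
  N²<[N+1]² : N * N < suc N * suc N
  N²<[N+1]² = s≤s (≤-trans (*-monoʳ-≤ N (n≤1+n N)) (m≤n+m (N * suc N) N))
  ^-cancelʳ-≤ : ∀ {a b} → 2 ^ a ≤ 2 ^ b → a ≤ b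
  ^-cancelʳ-≤ {a} {b} 2^a≤2^b = ≮⇒≥ (λ b<a → <⇒≱ (^-monoʳ-< 2 (s≤s (s≤s z≤n)) b<a) 2^a≤2^b)

-- X^k ≤ k^k 2^X ≤ 2 k^k N absorbs the logarithmic factor X into one extra power of N.
X^3k≤ : ∀ k → 0 < k → ∀ {N X} → 2 ^ X ≤ 2 * N → X ^ (3 * k) ≤ k ^ (3 * k) * (8 * N ^ 3)
X^3k≤ k k>0 {N} {X} 2^X≤2N = begin
  X ^ (3 * k)               ≡⟨ trans (cong (X ^_) (*-comm 3 k)) (sym (^-*-assoc X k 3)) ⟩
  (X ^ k) ^ 3               ≤⟨ ^-monoˡ-≤ 3 (≤-trans (n^m≤m^m*2^n k k>0 X) (*-monoʳ-≤ (k ^ k) 2^X≤2N)) ⟩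
  (k ^ k * (2 * N)) ^ 3     ≡⟨ ^-distribʳ-* (k ^ k) (2 * N) 3 ⟩
  (k ^ k) ^ 3 * (2 * N) ^ 3 ≡⟨ cong₂ _*_ (trans (^-*-assoc k k 3) (cong (k ^_) (*-comm k 3))) (cube-double N) ⟩
  k ^ (3 * k) * (8 * N ^ 3) ∎
  where
  open ≤-Reasoning
  cube-double : ∀ n → (2 * n) ^ 3 ≡ 8 * n ^ 3
  cube-double = solve 1 (λ n → (con 2 :* n) :^ 3 := con 8 :* n :^ 3) refl

power-bound : ∀ k → 0 < k → ∀ {N} X y P {S} → 2 ^ X ≤ 2 * N → y ^ 3 ≤ N → P ≤ 2 * X * y → S ≤ 3 * P →
              S ^ (3 * k) ≤ (12 * k) ^ (3 * k) * N ^ (k + 3)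
power-bound k k>0 {N} X y P {S} 2^X≤2N y³≤N P≤2Xy S≤3P = begin
  S ^ (3 * k)
    ≤⟨ ^-monoˡ-≤ (3 * k) S≤6Xy ⟩
  (6 * X * y) ^ (3 * k)
    ≡⟨ ^-distribʳ-* (6 * X) y (3 * k) ⟩
  (6 * X) ^ (3 * k) * y ^ (3 * k)
    ≡⟨ cong₂ _*_ (^-distribʳ-* 6 X (3 * k)) (sym (^-*-assoc y 3 k)) ⟩
  6 ^ (3 * k) * X ^ (3 * k) * (y ^ 3) ^ k
    ≤⟨ *-mono-≤ (*-monoʳ-≤ (6 ^ (3 * k)) (X^3k≤ k k>0 {N} 2^X≤2N)) (^-monoˡ-≤ k y³≤N) ⟩
  6 ^ (3 * k) * (k ^ (3 * k) * (8 * N ^ 3)) * N ^ k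
    ≤⟨ *-monoˡ-≤ (N ^ k) (*-monoʳ-≤ (6 ^ (3 * k)) (*-monoʳ-≤ (k ^ (3 * k)) (*-monoˡ-≤ (N ^ 3) 8≤2^3k))) ⟩
  6 ^ (3 * k) * (k ^ (3 * k) * (2 ^ (3 * k) * N ^ 3)) * N ^ k
    ≡⟨ regroup (6 ^ (3 * k)) (2 ^ (3 * k)) (k ^ (3 * k)) (N ^ 3) (N ^ k) ⟩
  6 ^ (3 * k) * 2 ^ (3 * k) * k ^ (3 * k) * (N ^ k * N ^ 3)
    ≡⟨ cong₂ _*_ (cong (_* k ^ (3 * k)) (sym (^-distribʳ-* 6 2 (3 * k)))) (sym (^-distribˡ-+-* N k 3)) ⟩
  12 ^ (3 * k) * k ^ (3 * k) * N ^ (k + 3)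
    ≡⟨ cong (_* N ^ (k + 3)) (sym (^-distribʳ-* 12 k (3 * k))) ⟩
  (12 * k) ^ (3 * k) * N ^ (k + 3)
    ∎
  where
  open ≤-Reasoning
  S≤6Xy : S ≤ 6 * X * y
  S≤6Xy = ≤-trans S≤3P (≤-trans (*-monoʳ-≤ 3 P≤2Xy) (≤-reflexive (sextuple X y)))
    where
    sextuple : ∀ x z → 3 * (2 * x * z) ≡ 6 * x * z
    sextuple = solve 2 (λ x z → con 3 :* (con 2 :* x :* z) := con 6 :* x :* z) refl
  8≤2^3k : 8 ≤ 2 ^ (3 * k)
  8≤2^3k = ^-monoʳ-≤ 2 (*-monoʳ-≤ 3 k>0)
  regroup : ∀ a b c d e → a * (c * (b * d)) * e ≡ a * b * c * (e * d)
  regroup = solve 5 (λ a b c d e → a :* (c :* (b :* d)) :* e := a :* b :* c :* (e :* d)) refl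

length≤length-flatten : ∀ ps → length ps ≤ length (flatten ps)
length≤length-flatten [] = z≤n
length≤length-flatten (_ ∷ ps) = s≤s (m≤n⇒m≤1+n (length≤length-flatten ps))

length-pairs≤ : ∀ ps {A rest} → A ↭ flatten ps ++ rest → length ps ≤ length A
length-pairs≤ ps A↭ = ≤-trans (length≤length-flatten ps)
  (≤-trans (List.length-++-≤ˡ (flatten ps)) (≤-reflexive (sym (↭.↭-length A↭))))

repeatedMass≤3*pairs : ∀ N A → ∃₂ λ ps rest → A ↭ flatten ps ++ rest ×
  All (λ ab → VLM N (proj₁ ab) ≡ VLM N (proj₂ ab)) ps × repeatedMass N A ≤ 3 * length ps
repeatedMass≤3*pairs N A = pairWithinFibres (≡-dec _≟_) (VLM N) (Rset N A) A
  (Unique.filter⁺ _ (DedupUnique.deduplicate-! (map (VLM N) A)))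
  (All.all-filter (λ r → 2 ≤? length (Ar N A r)) (deduplicate (≡-dec _≟_) (map (VLM N) A)))

proposition2p2 : ∀ (k : ℕ) → 1 ≤ k → ∃ λ (C : ℕ) →
    ∀ (N : ℕ) (A : List ℕ) → Unique A → All (λ a → 1 ≤ a × a ≤ N) A →
    DistinctSubsetProducts A →
    repeatedMass N A ^ (3 * k) ≤ C ^ (3 * k) * N ^ (k + 3)
proposition2p2 k@(suc _) k≥1 = 12 * k , bound
  where
  bound : ∀ N A → Unique A → All (λ a → 1 ≤ a × a ≤ N) A → DistinctSubsetProducts A →
          repeatedMass N A ^ (3 * k) ≤ (12 * k) ^ (3 * k) * N ^ (k + 3)
  bound zero [] _ _ _ = z≤n
  bound zero (_ ∷ _) _ ((1≤a , a≤0) ∷ _) _ = ⊥-elim (<⇒≱ 1≤a a≤0)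
  bound N@(suc _) A A-unique inRange distinct with repeatedMass≤3*pairs N A | binaryLength N z<s
  ... | ps , rest , A↭ , same , mass≤3P | X , N<2^X , 2^X≤2N =
    power-bound k k≥1 X y (length ps) 2^X≤2N (length-smallPrimes N) (exponent≤ X y 2^P≤ N<2^X) mass≤3P
    where
    y = length (smallPrimes N)
    P≤N = ≤-trans (length-pairs≤ ps A↭) (length≤bound A-unique inRange)
    2^P≤ = 2^pairs≤ ps rest A↭ distinct (All.++⁻ˡ (flatten ps) (↭.All-resp-↭ A↭ inRange)) same P≤N
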